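{- Every finite simple graph $G$ with exactly $5$ vertices satisfies $\mathrm{tww}(G)\le 2$.
   Context: A trigraph is a vertex set $V$ together with two disjoint sets of edges (unordered pairs of distinct vertices): black edges and red edges. A contraction of two distinct (not necessarily adjacent) vertices $u,v$ of a trigraph replaces them by a single new vertex $w$; every vertex $x\neq u,v$ that is adjacent (by an edge of either colour) to exactly one of $u,v$ becomes joined to $w$ by a red edge; every $x$ adjacent to both becomes joined to $w$ by a black edge if $ux$ and $vx$ are both black and by a red edge otherwise; all edges not incident to $u$ or $v$ are unchanged. A simple graph is viewed as a trigraph with no red edges. A $d$-sequence for an $n$-vertex graph $G$ is a sequence of trigraphs $G=G_n,G_{n-1},\dots,G_1$ in which each $G_{i-1}$ is obtained from $G_i$ by one contraction and every vertex of every $G_i$ is incident to at most $d$ red edges. The twin-width $\mathrm{tww}(G)$ is the least $d$ for which $G$ admits a $d$-sequence. -}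

module Defs where

open import Data.Nat using (ℕ; zero; suc; _+_; _≤_)
open import Data.Bool using (Bool; true; false)
open import Data.Fin using (Fin; zero; suc; punchIn; punchOut; _≟_)
open import Relation.Nullary using (yes; no; ¬_)
open import Relation.Binary.PropositionalEquality using (_≡_)

data Col : Set where
  none  : Col
  black : Col
  red   : Col

-- A trigraph on vertex set Fin n: colour of each pair (symmetric and
-- irreflexive for all trigraphs reachable from a simple graph).
Trigraph : ℕ → Set
Trigraph n = Fin n → Fin n → Col

record SimpleGraph (n : ℕ) : Set where
  field
    adj    : Fin n → Fin n → Bool
    sym    : ∀ i j → adj i j ≡ adj j i
    irrefl : ∀ i → adj i i ≡ false

toTrigraph : ∀ {n} → SimpleGraph n → Trigraph n
toTrigraph G i j with SimpleGraph.adj G i j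
... | true  = black
... | false = none

-- Colour of the edge w x after contracting u,v into w, given the colours
-- of u x and v x.
merge : Col → Col → Col
merge none  none  = none
merge black black = black
merge _     _     = red

-- The vertices of the result are the old vertices other than v
-- (vertex y of the result is old vertex punchIn v y); the new vertex w
-- takes the position of u, i.e. w = punchOut (v ≢ u).
contract : ∀ {n} → Trigraph (suc n) → (u v : Fin (suc n)) → ¬ (v ≡ u) → Trigraph n
contract {n} T u v v≢u x y with x ≟ w | y ≟ w
  where
    w : Fin n
    w = punchOut v≢u
... | yes _ | yes _ = none
... | yes _ | no  _ = merge (T u (punchIn v y)) (T v (punchIn v y))
... | no  _ | yes _ = merge (T u (punchIn v x)) (T v (punchIn v x))
... | no  _ | no  _ = T (punchIn v x) (punchIn v y)

isRed : Col → ℕ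
isRed red = 1
isRed _   = 0

sumFin : ∀ {n} → (Fin n → ℕ) → ℕ
sumFin {zero}  f = 0
sumFin {suc n} f = f zero + sumFin (λ i → f (suc i))

redDeg : ∀ {n} → Trigraph n → Fin n → ℕ
redDeg T x = sumFin (λ y → isRed (T x y))

RedBounded : ∀ {n} → ℕ → Trigraph n → Set
RedBounded d T = ∀ x → redDeg T x ≤ d

data DSeq (d : ℕ) : (n : ℕ) → Trigraph (suc n) → Set where
  done : (T : Trigraph 1) → RedBounded d T → DSeq d zero T
  step : ∀ {n} (T : Trigraph (suc (suc n))) → RedBounded d T →
         (u v : Fin (suc (suc n))) (v≢u : ¬ (v ≡ u)) →
         DSeq d n (contract T u v v≢u) → DSeq d (suc n) T

-- tww(G) ≤ d  iff  G admits a d-sequence (d-sequences are also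
-- d'-sequences for d' ≥ d, so the least such d is ≤ d exactly then).
TwwAtMost : ∀ {n} → ℕ → SimpleGraph (suc n) → Set
TwwAtMost {n} d G = DSeq d n (toTrigraph G)

{-# OPTIONS --safe #-}
-- There are only 2^10 graphs on five labelled vertices, so the theorem is a
-- finite check: a depth-first search over contraction sequences, which
-- returns certified d-sequences, finds a 2-sequence for each of them.
module Submission where

open import Defs
open import Data.Nat using (ℕ; zero; suc; _+_; _≤_; _≤?_)
open import Data.Bool using (Bool; true; false; _∧_; T)
open import Data.Bool.Properties using (T-∧)
open import Data.Fin using (Fin; zero; suc; punchIn; punchOut; _≟_)
open import Data.Fin.Properties using (all?; punchInᵢ≢i)
open import Data.Vec using (Vec; []; _∷_; lookup; tabulate)
open import Data.Vec.Properties using (lookup∘tabulate)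
open import Data.List using (foldr; cartesianProductWith; allFin)
open import Data.Maybe using (Maybe; just; nothing; is-just; _<∣>_; to-witness-T)
import Data.Maybe as Maybe
open import Data.Product using (_×_; _,_; proj₁; proj₂)
open import Data.Unit using (⊤; tt)
open import Function using (_∘_)
open import Function.Bundles using (Equivalence)
open import Relation.Nullary using (Dec; yes; no)
open import Relation.Binary.PropositionalEquality using (_≡_; _≢_; refl; sym; trans; cong; cong₂; subst)

private
  variable
    d n : ℕ

_≗₂_ : Trigraph n → Trigraph n → Set
A ≗₂ B = ∀ x y → A x y ≡ B x y

sumFin-cong : (f g : Fin n → ℕ) → (∀ i → f i ≡ g i) → sumFin f ≡ sumFin g
sumFin-cong {zero}  f g f≗g = refl
sumFin-cong {suc n} f g f≗g =
  cong₂ _+_ (f≗g zero) (sumFin-cong (f ∘ suc) (g ∘ suc) (f≗g ∘ suc))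

RedBounded-resp : {A B : Trigraph n} → A ≗₂ B → RedBounded d A → RedBounded d B
RedBounded-resp {d = d} A≗B bounded x =
  subst (_≤ d) (sumFin-cong _ _ (cong isRed ∘ A≗B x)) (bounded x)

contract-cong : (A B : Trigraph (suc n)) (u v : Fin (suc n)) (v≢u : v ≢ u) →
                A ≗₂ B → contract A u v v≢u ≗₂ contract B u v v≢u
contract-cong A B u v v≢u A≗B x y with x ≟ punchOut v≢u | y ≟ punchOut v≢u
... | yes _ | yes _ = refl
... | yes _ | no  _ = cong₂ merge (A≗B u (punchIn v y)) (A≗B v (punchIn v y))
... | no  _ | yes _ = cong₂ merge (A≗B u (punchIn v x)) (A≗B v (punchIn v x))
... | no  _ | no  _ = A≗B (punchIn v x) (punchIn v y)

DSeq-resp : {A B : Trigraph (suc n)} → A ≗₂ B → DSeq d n A → DSeq d n B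
DSeq-resp A≗B (done _ bounded) = done _ (RedBounded-resp A≗B bounded)
DSeq-resp {B = B} A≗B (step A bounded u v v≢u rest) =
  step B (RedBounded-resp A≗B bounded) u v v≢u
       (DSeq-resp (contract-cong A B u v v≢u A≗B) rest)

redBounded? : (d : ℕ) (A : Trigraph n) → Dec (RedBounded d A)
redBounded? d A = all? (λ x → redDeg A x ≤? d)

dSeq? : (d n : ℕ) (A : Trigraph (suc n)) → Maybe (DSeq d n A)
dSeq? d n A with redBounded? d A
... | no _ = nothing
dSeq? d zero    A | yes bounded = just (done A bounded)
dSeq? d (suc n) A | yes bounded =
  foldr _<∣>_ nothing (cartesianProductWith tryContraction (allFin _) (allFin _))
  where
  tryContraction : (u : Fin (suc (suc n))) (j : Fin (suc n)) → Maybe (DSeq d (suc n) A)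
  tryContraction u j =
    Maybe.map (step A bounded u (punchIn u j) (punchInᵢ≢i u j))
              (dSeq? d n (contract A u (punchIn u j) (punchInᵢ≢i u j)))

-- A graph on Fin (suc n) is coded by the neighbours of vertex 0 among the
-- other vertices together with the code of the graph on those vertices.
AdjCode : ℕ → Set
AdjCode zero    = ⊤
AdjCode (suc n) = Vec Bool n × AdjCode n

decode : AdjCode n → Fin n → Fin n → Bool
decode (_  , _) zero    zero    = false
decode (nb , _) zero    (suc j) = lookup nb j
decode (nb , _) (suc i) zero    = lookup nb i
decode (_  , a) (suc i) (suc j) = decode a i j

encode : (Fin n → Fin n → Bool) → AdjCode n
encode {zero}  adj = tt
encode {suc n} adj = tabulate (adj zero ∘ suc) , encode (λ i j → adj (suc i) (suc j))

decode-encode : (adj : Fin n → Fin n → Bool) →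
                (∀ i j → adj i j ≡ adj j i) → (∀ i → adj i i ≡ false) →
                ∀ i j → decode (encode adj) i j ≡ adj i j
decode-encode adj adj-sym adj-irrefl zero    zero    = sym (adj-irrefl zero)
decode-encode adj adj-sym adj-irrefl zero    (suc j) = lookup∘tabulate (adj zero ∘ suc) j
decode-encode adj adj-sym adj-irrefl (suc i) zero    =
  trans (lookup∘tabulate (adj zero ∘ suc) i) (adj-sym zero (suc i))
decode-encode adj adj-sym adj-irrefl (suc i) (suc j) =
  decode-encode (λ i j → adj (suc i) (suc j))
                (λ i j → adj-sym (suc i) (suc j)) (adj-irrefl ∘ suc) i j

allVec : (n : ℕ) → (Vec Bool n → Bool) → Bool
allVec zero    p = p []
allVec (suc n) p = allVec n (p ∘ (true ∷_)) ∧ allVec n (p ∘ (false ∷_))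

allVec-sound : (n : ℕ) (p : Vec Bool n → Bool) → T (allVec n p) → ∀ v → T (p v)
allVec-sound zero    p holds []          = holds
allVec-sound (suc n) p holds (true  ∷ v) =
  allVec-sound n _ (proj₁ (Equivalence.to T-∧ holds)) v
allVec-sound (suc n) p holds (false ∷ v) =
  allVec-sound n _ (proj₂ (Equivalence.to T-∧ holds)) v

allCodes : (n : ℕ) → (AdjCode n → Bool) → Bool
allCodes zero    p = p tt
allCodes (suc n) p = allVec n (λ nb → allCodes n (λ a → p (nb , a)))

allCodes-sound : (n : ℕ) (p : AdjCode n → Bool) → T (allCodes n p) → ∀ a → T (p a)
allCodes-sound zero    p holds tt       = holds
allCodes-sound (suc n) p holds (nb , a) =
  allCodes-sound n _ (allVec-sound n _ holds nb) a

colour : Bool → Col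
colour true  = black
colour false = none

toTrigraph-colour : (G : SimpleGraph n) → toTrigraph G ≗₂ (λ x y → colour (SimpleGraph.adj G x y))
toTrigraph-colour G x y with SimpleGraph.adj G x y
... | true  = refl
... | false = refl

codeTrigraph : AdjCode n → Trigraph n
codeTrigraph a x y = colour (decode a x y)

codeTrigraph-encode : (G : SimpleGraph n) →
                      codeTrigraph (encode (SimpleGraph.adj G)) ≗₂ toTrigraph G
codeTrigraph-encode G x y =
  trans (cong colour (decode-encode adj sym′ irrefl x y))
        (sym (toTrigraph-colour G x y))
  where open SimpleGraph G renaming (sym to sym′)

has2Sequence : AdjCode 5 → Bool
has2Sequence = is-just ∘ dSeq? 2 4 ∘ codeTrigraph

allCodes-has2Sequence : T (allCodes 5 has2Sequence)
allCodes-has2Sequence = tt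

theorem1p2 : (G : SimpleGraph 5) → TwwAtMost 2 G
theorem1p2 G =
  DSeq-resp (codeTrigraph-encode G)
    (to-witness-T (dSeq? 2 4 (codeTrigraph a))
                  (allCodes-sound 5 has2Sequence allCodes-has2Sequence a))
  where
  a : AdjCode 5
  a = encode (SimpleGraph.adj G)
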